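{- Let $e,n$ be nonnegative integers. Then, as an identity of polynomials in $q$, \[ \sum_{k=0}^n \binom{n}{k}_q\, q^{k^2+ek}\prod_{j= k+1+e}^{n+e}(1- q^{j}) = 1. \]
   Context: $\binom{n}{k}_q=\frac{[n]_q!}{[k]_q![n-k]_q!}$ is the Gaussian binomial coefficient, where $[n]_q!=\prod_{i=1}^n(1+q+\dots+q^{i-1})$. An empty product equals $1$. -}

module Defs where

open import Data.Nat as ℕ using (ℕ; zero; suc; _∸_)
open import Data.Integer as ℤ using (ℤ; +_; 0ℤ; 1ℤ)
open import Data.List using (List; []; _∷_; reverse; length; replicate; foldr)
open import Relation.Binary.PropositionalEquality using (_≡_)
open import Relation.Nullary using (yes; no)

-- Polynomials in q with integer coefficients, as coefficient lists,
-- lowest degree first: a₀ ∷ a₁ ∷ … represents a₀ + a₁ q + …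
Poly : Set
Poly = List ℤ

private
  dropZ : List ℤ → List ℤ
  dropZ [] = []
  dropZ (a ∷ as) with a ℤ.≟ 0ℤ
  ... | yes _ = dropZ as
  ... | no _ = a ∷ as

normalize : Poly → Poly
normalize p = reverse (dropZ (reverse p))

_≈P_ : Poly → Poly → Set
p ≈P r = normalize p ≡ normalize r
infix 4 _≈P_

_+P_ : Poly → Poly → Poly
[] +P r = r
(a ∷ p) +P [] = a ∷ p
(a ∷ p) +P (b ∷ r) = (a ℤ.+ b) ∷ (p +P r)
infixl 6 _+P_

scaleP : ℤ → Poly → Poly
scaleP c [] = []
scaleP c (a ∷ p) = (c ℤ.* a) ∷ scaleP c p

negP : Poly → Poly
negP = scaleP (ℤ.- 1ℤ)

_-P_ : Poly → Poly → Poly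
p -P r = p +P negP r
infixl 6 _-P_

_*P_ : Poly → Poly → Poly
[] *P r = []
(a ∷ p) *P r = scaleP a r +P (0ℤ ∷ (p *P r))
infixl 7 _*P_

constP : ℤ → Poly
constP c = c ∷ []

oneP : Poly
oneP = constP 1ℤ

qPow : ℕ → Poly
qPow m = replicate m 0ℤ Data.List.++ (1ℤ ∷ [])
  where import Data.List

sumP : ℕ → (ℕ → Poly) → Poly
sumP zero f = f 0
sumP (suc n) f = sumP n f +P f (suc n)

-- ∏_{j=a}^{b} f j  (empty product = 1 when b < a)
prodFromTo : ℕ → ℕ → (ℕ → Poly) → Poly
prodFromTo a b f = go (suc b ∸ a) a
  where
  go : ℕ → ℕ → Poly
  go zero i = oneP
  go (suc c) i = f i *P go c (suc i)

qInt : ℕ → Poly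
qInt i = replicate i 1ℤ

qFact : ℕ → Poly
qFact n = prodFromTo 1 n qInt

-- Division by a monic polynomial (leading coefficient 1), by long division.
-- For d monic, divMonic p d returns the quotient Q with p = Q·d + R, deg R < deg d.
private
  lastOr0 : List ℤ → ℤ
  lastOr0 [] = 0ℤ
  lastOr0 (a ∷ []) = a
  lastOr0 (a ∷ b ∷ as) = lastOr0 (b ∷ as)

  divGo : ℕ → Poly → Poly → Poly
  divGo zero p d = []
  divGo (suc fuel) p d with length p ℕ.<? length d
  ... | yes _ = []
  ... | no _ =
    let c = lastOr0 p
        s = length p ∸ length d
        t = scaleP c (qPow s)
    in t +P divGo fuel (normalize (p -P (t *P d))) d

divMonic : Poly → Poly → Poly
divMonic p d = divGo (suc (length p)) (normalize p) (normalize d)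

-- Gaussian binomial coefficient  [n choose k]_q = [n]_q! / ([k]_q! [n-k]_q!)
-- (the denominator is monic, and the quotient is exact).
qBinom : ℕ → ℕ → Poly
qBinom n k = divMonic (qFact n) (qFact k *P qFact (n ∸ k))

-- Write Sₑ(n) for the left-hand side.  By the q-Pascal rule [n+1, k] = q^k [n, k] + [n, k-1],
-- every summand of Sₑ(n+1) splits into a term carrying [n, k] and a term carrying [n, k-1].
-- The two terms carrying [n, k] agree except at j = k+1+e: one has the factor 1 - q^j in its
-- product, the other an extra q^j in its power of q.  As (1 - q^j) + q^j = 1, together they
-- give the k-th summand of S_{e+1}(n).  Hence Sₑ(n+1) = S_{e+1}(n), and Sₑ(0) = 1.
-- The quotient defining `qBinom` is exact because [k+m]! = [k+m, k] [k]! [m]! by the same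
-- Pascal rule, and long division by the monic [k]! [m]! recovers an exact quotient.
module Submission where

open import Defs
open import Data.Nat using (ℕ; _+_; _*_; suc)
open import Data.Nat using (zero; _∸_; _≤_; _<_; z≤n; s≤s; _<?_)
import Data.Nat.Properties as ℕₚ
open import Data.Nat.Tactic.RingSolver using (solve-∀)
open import Data.Integer as ℤ using (ℤ; 0ℤ; 1ℤ; -1ℤ) renaming (_+_ to _+ℤ_; _*_ to _*ℤ_)
import Data.Integer.Properties as ℤₚ
open import Data.Integer.Solver using (module +-*-Solver)
open import Data.List using ([]; _∷_; _∷ʳ_; length; reverse)
import Data.List.Properties as Listₚ
open import Data.List.Reverse using (Reverse; reverseView; []; _∶_∶ʳ_)
open import Data.Product using (∃; _×_; _,_; proj₁; proj₂)
open import Data.Sum using (_⊎_; inj₁; inj₂)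
open import Data.Empty using (⊥-elim)
open import Relation.Nullary using (Dec; yes; no)
open import Relation.Binary using (Setoid; IsEquivalence)
open import Relation.Binary.PropositionalEquality
open import Algebra using (CommutativeMonoid; CommutativeSemiring)
open import Algebra.Structures.Biased using (IsCommutativeSemiringˡ)
import Relation.Binary.Reasoning.Setoid as SetoidReasoning
import Algebra.Properties.CommutativeSemigroup as CommSemigroupProperties
import Algebra.Solver.Ring.NaturalCoefficients.Default as NaturalCoefficientSolver

coeff : Poly → ℕ → ℤ
coeff []      _       = 0ℤ
coeff (a ∷ p) zero    = a
coeff (a ∷ p) (suc i) = coeff p i

infix 4 _≐_
record _≐_ (p r : Poly) : Set where
  constructor coeffwise
  field at : ∀ i → coeff p i ≡ coeff r i
open _≐_

≐-refl : ∀ {p} → p ≐ p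
≐-refl = coeffwise λ _ → refl

≐-sym : ∀ {p r} → p ≐ r → r ≐ p
≐-sym p≐r = coeffwise λ i → sym (at p≐r i)

≐-trans : ∀ {p r s} → p ≐ r → r ≐ s → p ≐ s
≐-trans p≐r r≐s = coeffwise λ i → trans (at p≐r i) (at r≐s i)

≡⇒≐ : ∀ {p r} → p ≡ r → p ≐ r
≡⇒≐ refl = ≐-refl

≐-isEquivalence : IsEquivalence _≐_
≐-isEquivalence = record { refl = ≐-refl ; sym = ≐-sym ; trans = ≐-trans }

≐-setoid : Setoid _ _
≐-setoid = record { isEquivalence = ≐-isEquivalence }

module ≐-Reasoning = SetoidReasoning ≐-setoid

∷-cong : ∀ {a b p r} → a ≡ b → p ≐ r → a ∷ p ≐ b ∷ r
∷-cong a≡b p≐r = coeffwise λ { zero → a≡b ; (suc i) → at p≐r i }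

∷-≐-[] : ∀ {a p} → a ≡ 0ℤ → p ≐ [] → a ∷ p ≐ []
∷-≐-[] a≡0 p≐0 = coeffwise λ { zero → a≡0 ; (suc i) → at p≐0 i }

∷-≐-[]-tail : ∀ {a p} → a ∷ p ≐ [] → p ≐ []
∷-≐-[]-tail e = coeffwise λ i → at e (suc i)

∷-injectiveʳ : ∀ {a b p r} → a ∷ p ≐ b ∷ r → p ≐ r
∷-injectiveʳ e = coeffwise λ i → at e (suc i)

coeff-+P : ∀ p r i → coeff (p +P r) i ≡ coeff p i +ℤ coeff r i
coeff-+P []      r       i       = sym (ℤₚ.+-identityˡ _)
coeff-+P (a ∷ p) []      i       = sym (ℤₚ.+-identityʳ _)
coeff-+P (a ∷ p) (b ∷ r) zero    = refl
coeff-+P (a ∷ p) (b ∷ r) (suc i) = coeff-+P p r i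

coeff-scaleP : ∀ c p i → coeff (scaleP c p) i ≡ c *ℤ coeff p i
coeff-scaleP c []      i       = sym (ℤₚ.*-zeroʳ c)
coeff-scaleP c (a ∷ p) zero    = refl
coeff-scaleP c (a ∷ p) (suc i) = coeff-scaleP c p i

coeff-subP : ∀ p r i → coeff (p -P r) i ≡ coeff p i +ℤ -1ℤ *ℤ coeff r i
coeff-subP p r i = trans (coeff-+P p (negP r) i) (cong (coeff p i +ℤ_) (coeff-scaleP -1ℤ r i))

coeff-qPow-self : ∀ a → coeff (qPow a) a ≡ 1ℤ
coeff-qPow-self zero    = refl
coeff-qPow-self (suc a) = coeff-qPow-self a

coeff-qPow-> : ∀ a i → a < i → coeff (qPow a) i ≡ 0ℤ
coeff-qPow-> zero    (suc i) _       = refl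
coeff-qPow-> (suc a) (suc i) (s≤s h) = coeff-qPow-> a i h

+P-cong : ∀ {p p′ r r′} → p ≐ p′ → r ≐ r′ → p +P r ≐ p′ +P r′
+P-cong {p} {p′} {r} {r′} e f = coeffwise λ i →
  trans (coeff-+P p r i) (trans (cong₂ _+ℤ_ (at e i) (at f i)) (sym (coeff-+P p′ r′ i)))

+P-comm : ∀ p r → p +P r ≐ r +P p
+P-comm p r = coeffwise λ i →
  trans (coeff-+P p r i) (trans (ℤₚ.+-comm (coeff p i) (coeff r i)) (sym (coeff-+P r p i)))

+P-assoc : ∀ p r s → (p +P r) +P s ≐ p +P (r +P s)
+P-assoc p r s = coeffwise λ i →
  trans (coeff-+P (p +P r) s i) (trans (cong (_+ℤ coeff s i) (coeff-+P p r i))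
    (trans (ℤₚ.+-assoc (coeff p i) (coeff r i) (coeff s i))
      (sym (trans (coeff-+P p (r +P s) i) (cong (coeff p i +ℤ_) (coeff-+P r s i))))))

+P-identityʳ : ∀ p → p +P [] ≐ p
+P-identityʳ p = coeffwise λ i → trans (coeff-+P p [] i) (ℤₚ.+-identityʳ _)

+P-commutativeMonoid : CommutativeMonoid _ _
+P-commutativeMonoid = record
  { _≈_ = _≐_ ; _∙_ = _+P_ ; ε = []
  ; isCommutativeMonoid = record
    { isMonoid = record
      { isSemigroup = record
        { isMagma = record { isEquivalence = ≐-isEquivalence ; ∙-cong = +P-cong }
        ; assoc = +P-assoc }
      ; identity = (λ _ → ≐-refl) , +P-identityʳ }
    ; comm = +P-comm } }

open CommSemigroupProperties (CommutativeMonoid.commutativeSemigroup +P-commutativeMonoid)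
  using () renaming (interchange to +P-interchange; x∙yz≈y∙xz to +P-swapˡ)

scaleP-cong : ∀ c {p r} → p ≐ r → scaleP c p ≐ scaleP c r
scaleP-cong c {p} {r} e = coeffwise λ i →
  trans (coeff-scaleP c p i) (trans (cong (c *ℤ_) (at e i)) (sym (coeff-scaleP c r i)))

scaleP-distribˡ : ∀ c p r → scaleP c (p +P r) ≐ scaleP c p +P scaleP c r
scaleP-distribˡ c p r = coeffwise λ i →
  trans (coeff-scaleP c (p +P r) i) (trans (cong (c *ℤ_) (coeff-+P p r i))
    (trans (ℤₚ.*-distribˡ-+ c _ _)
      (sym (trans (coeff-+P (scaleP c p) (scaleP c r) i)
                  (cong₂ _+ℤ_ (coeff-scaleP c p i) (coeff-scaleP c r i))))))

scaleP-distribʳ : ∀ c d p → scaleP (c +ℤ d) p ≐ scaleP c p +P scaleP d p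
scaleP-distribʳ c d p = coeffwise λ i →
  trans (coeff-scaleP (c +ℤ d) p i) (trans (ℤₚ.*-distribʳ-+ _ c d)
    (sym (trans (coeff-+P (scaleP c p) (scaleP d p) i) (cong₂ _+ℤ_ (coeff-scaleP c p i) (coeff-scaleP d p i)))))

scaleP-scaleP : ∀ c d p → scaleP c (scaleP d p) ≐ scaleP (c *ℤ d) p
scaleP-scaleP c d p = coeffwise λ i →
  trans (coeff-scaleP c (scaleP d p) i) (trans (cong (c *ℤ_) (coeff-scaleP d p i))
    (trans (sym (ℤₚ.*-assoc c d _)) (sym (coeff-scaleP (c *ℤ d) p i))))

scaleP-zero : ∀ {c} p → c ≡ 0ℤ → scaleP c p ≐ []
scaleP-zero p refl = coeffwise λ i → trans (coeff-scaleP 0ℤ p i) (ℤₚ.*-zeroˡ (coeff p i))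

scaleP-one : ∀ p → scaleP 1ℤ p ≐ p
scaleP-one p = coeffwise λ i → trans (coeff-scaleP 1ℤ p i) (ℤₚ.*-identityˡ _)

*P-zeroˡ : ∀ p r → p ≐ [] → p *P r ≐ []
*P-zeroˡ []      r _   = ≐-refl
*P-zeroˡ (a ∷ p) r p≐0 =
  +P-cong (scaleP-zero r (at p≐0 zero)) (∷-≐-[] refl (*P-zeroˡ p r (∷-≐-[]-tail p≐0)))

*P-zeroʳ : ∀ p → p *P [] ≐ []
*P-zeroʳ []      = ≐-refl
*P-zeroʳ (a ∷ p) = ∷-≐-[] refl (*P-zeroʳ p)

*P-congˡ : ∀ {p p′} r → p ≐ p′ → p *P r ≐ p′ *P r
*P-congˡ {[]}    {p′}     r e = ≐-sym (*P-zeroˡ p′ r (≐-sym e))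
*P-congˡ {a ∷ p} {[]}     r e = *P-zeroˡ (a ∷ p) r e
*P-congˡ {a ∷ p} {b ∷ p′} r e =
  +P-cong (≡⇒≐ (cong (λ c → scaleP c r) (at e zero))) (∷-cong refl (*P-congˡ r (∷-injectiveʳ e)))

*P-congʳ : ∀ p {r r′} → r ≐ r′ → p *P r ≐ p *P r′
*P-congʳ []      e = ≐-refl
*P-congʳ (a ∷ p) e = +P-cong (scaleP-cong a e) (∷-cong refl (*P-congʳ p e))

*P-cong : ∀ {p p′ r r′} → p ≐ p′ → r ≐ r′ → p *P r ≐ p′ *P r′
*P-cong {p′ = p′} {r = r} e f = ≐-trans (*P-congˡ r e) (*P-congʳ p′ f)

*P-∷ʳ : ∀ p b r → p *P (b ∷ r) ≐ scaleP b p +P (0ℤ ∷ p *P r)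
*P-∷ʳ []      b r = ≐-sym (∷-≐-[] refl ≐-refl)
*P-∷ʳ (a ∷ p) b r =
  ∷-cong (trans (ℤₚ.+-identityʳ _) (trans (ℤₚ.*-comm a b) (sym (ℤₚ.+-identityʳ _)))) (begin
  scaleP a r +P p *P (b ∷ r)                     ≈⟨ +P-cong (≐-refl {scaleP a r}) (*P-∷ʳ p b r) ⟩
  scaleP a r +P (scaleP b p +P (0ℤ ∷ p *P r))    ≈⟨ +P-swapˡ (scaleP a r) (scaleP b p) _ ⟩
  scaleP b p +P (scaleP a r +P (0ℤ ∷ p *P r))    ∎)
  where open ≐-Reasoning

*P-comm : ∀ p r → p *P r ≐ r *P p
*P-comm []      r = ≐-sym (*P-zeroʳ r)
*P-comm (a ∷ p) r =
  ≐-sym (≐-trans (*P-∷ʳ r a p) (+P-cong (≐-refl {scaleP a r}) (∷-cong refl (*P-comm r p))))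

*P-distribʳ : ∀ p r s → (p +P r) *P s ≐ p *P s +P r *P s
*P-distribʳ []      r       s = ≐-refl
*P-distribʳ (a ∷ p) []      s = ≐-sym (+P-identityʳ _)
*P-distribʳ (a ∷ p) (b ∷ r) s = begin
  scaleP (a +ℤ b) s +P (0ℤ ∷ (p +P r) *P s)
    ≈⟨ +P-cong (scaleP-distribʳ a b s) (∷-cong refl (*P-distribʳ p r s)) ⟩
  (scaleP a s +P scaleP b s) +P ((0ℤ ∷ p *P s) +P (0ℤ ∷ r *P s))
    ≈⟨ +P-interchange (scaleP a s) _ _ _ ⟩
  (scaleP a s +P (0ℤ ∷ p *P s)) +P (scaleP b s +P (0ℤ ∷ r *P s)) ∎
  where open ≐-Reasoning

scaleP-*P : ∀ c p r → scaleP c (p *P r) ≐ scaleP c p *P r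
scaleP-*P c []      r = ≐-refl
scaleP-*P c (a ∷ p) r = begin
  scaleP c (scaleP a r +P (0ℤ ∷ p *P r))                 ≈⟨ scaleP-distribˡ c (scaleP a r) _ ⟩
  scaleP c (scaleP a r) +P (c *ℤ 0ℤ ∷ scaleP c (p *P r))
    ≈⟨ +P-cong (scaleP-scaleP c a r) (∷-cong (ℤₚ.*-zeroʳ c) (scaleP-*P c p r)) ⟩
  scaleP (c *ℤ a) r +P (0ℤ ∷ scaleP c p *P r)            ∎
  where open ≐-Reasoning

0∷-*P : ∀ p r → (0ℤ ∷ p) *P r ≐ 0ℤ ∷ p *P r
0∷-*P p r = +P-cong (scaleP-zero r refl) (≐-refl {0ℤ ∷ p *P r})

*P-assoc : ∀ p r s → (p *P r) *P s ≐ p *P (r *P s)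
*P-assoc []      r s = ≐-refl
*P-assoc (a ∷ p) r s = begin
  (scaleP a r +P (0ℤ ∷ p *P r)) *P s           ≈⟨ *P-distribʳ (scaleP a r) _ s ⟩
  scaleP a r *P s +P (0ℤ ∷ p *P r) *P s        ≈⟨ +P-cong (≐-sym (scaleP-*P a r s)) (0∷-*P (p *P r) s) ⟩
  scaleP a (r *P s) +P (0ℤ ∷ (p *P r) *P s)
    ≈⟨ +P-cong (≐-refl {scaleP a (r *P s)}) (∷-cong refl (*P-assoc p r s)) ⟩
  scaleP a (r *P s) +P (0ℤ ∷ p *P (r *P s))    ∎
  where open ≐-Reasoning

*P-identityˡ : ∀ p → oneP *P p ≐ p
*P-identityˡ p = ≐-trans (+P-cong (scaleP-one p) (∷-≐-[] refl ≐-refl)) (+P-identityʳ p)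

*P-identityʳ : ∀ p → p *P oneP ≐ p
*P-identityʳ p = ≐-trans (*P-comm p oneP) (*P-identityˡ p)

polyCommutativeSemiring : CommutativeSemiring _ _
polyCommutativeSemiring = record
  { _≈_ = _≐_ ; _+_ = _+P_ ; _*_ = _*P_ ; 0# = [] ; 1# = oneP
  ; isCommutativeSemiring = IsCommutativeSemiringˡ.isCommutativeSemiring (record
    { +-isCommutativeMonoid = CommutativeMonoid.isCommutativeMonoid +P-commutativeMonoid
    ; *-isCommutativeMonoid = record
      { isMonoid = record
        { isSemigroup = record
          { isMagma = record { isEquivalence = ≐-isEquivalence ; ∙-cong = *P-cong }
          ; assoc = *P-assoc }
        ; identity = *P-identityˡ , *P-identityʳ }
      ; comm = *P-comm }
    ; distribʳ = λ p r s → *P-distribʳ r s p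
    ; zeroˡ = λ _ → ≐-refl }) }

module PolySolver = NaturalCoefficientSolver polyCommutativeSemiring

consTrim : ℤ → Poly → Poly
consTrim a [] with a ℤ.≟ 0ℤ
... | yes _ = []
... | no  _ = a ∷ []
consTrim a (b ∷ p) = a ∷ b ∷ p

trim : Poly → Poly
trim []      = []
trim (a ∷ p) = consTrim a (trim p)

Trimmed : Poly → Set
Trimmed p = trim p ≡ p

trim-∷ʳ-0 : ∀ p → trim (p ∷ʳ 0ℤ) ≡ trim p
trim-∷ʳ-0 []      = refl
trim-∷ʳ-0 (a ∷ p) = cong (consTrim a) (trim-∷ʳ-0 p)

trim-∷ʳ-≢0 : ∀ p {a} → a ≢ 0ℤ → trim (p ∷ʳ a) ≡ p ∷ʳ a
trim-∷ʳ-≢0 [] {a} a≢0 with a ℤ.≟ 0ℤ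
... | yes a≡0 = ⊥-elim (a≢0 a≡0)
... | no  _   = refl
trim-∷ʳ-≢0 (b ∷ [])    a≢0 rewrite trim-∷ʳ-≢0 [] a≢0 = refl
trim-∷ʳ-≢0 (b ∷ c ∷ p) a≢0 rewrite trim-∷ʳ-≢0 (c ∷ p) a≢0 = refl

normalize-∷ʳ-0 : ∀ p → normalize (p ∷ʳ 0ℤ) ≡ normalize p
normalize-∷ʳ-0 p rewrite Listₚ.reverse-++ p (0ℤ ∷ []) = refl

normalize-∷ʳ-≢0 : ∀ p {a} → a ≢ 0ℤ → normalize (p ∷ʳ a) ≡ p ∷ʳ a
normalize-∷ʳ-≢0 p {a} a≢0 rewrite Listₚ.reverse-++ p (a ∷ []) with a ℤ.≟ 0ℤ
... | yes a≡0 = ⊥-elim (a≢0 a≡0)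
... | no  _   = trans (Listₚ.unfold-reverse a (reverse p)) (cong (_∷ʳ a) (Listₚ.reverse-involutive p))

normalize≡trim : ∀ p → normalize p ≡ trim p
normalize≡trim p = go (reverseView p)
  where
  go : ∀ {p} → Reverse p → normalize p ≡ trim p
  go [] = refl
  go (p ∶ view ∶ʳ a) with a ℤ.≟ 0ℤ
  ... | yes refl = trans (normalize-∷ʳ-0 p) (trans (go view) (sym (trim-∷ʳ-0 p)))
  ... | no  a≢0  = trans (normalize-∷ʳ-≢0 p a≢0) (sym (trim-∷ʳ-≢0 p a≢0))

consTrim-≐ : ∀ a p → consTrim a p ≐ a ∷ p
consTrim-≐ a [] with a ℤ.≟ 0ℤ
... | yes a≡0 = ≐-sym (∷-≐-[] a≡0 ≐-refl)
... | no  _   = ≐-refl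
consTrim-≐ a (b ∷ p) = ≐-refl

trim-≐ : ∀ p → trim p ≐ p
trim-≐ []      = ≐-refl
trim-≐ (a ∷ p) = ≐-trans (consTrim-≐ a (trim p)) (∷-cong refl (trim-≐ p))

trim-≐-[] : ∀ {p} → p ≐ [] → trim p ≡ []
trim-≐-[] {[]}    _   = refl
trim-≐-[] {a ∷ p} p≐0 rewrite trim-≐-[] (∷-≐-[]-tail p≐0) with a ℤ.≟ 0ℤ
... | yes _   = refl
... | no  a≢0 = ⊥-elim (a≢0 (at p≐0 zero))

trim-cong : ∀ {p r} → p ≐ r → trim p ≡ trim r
trim-cong {[]}    {r}     e = sym (trim-≐-[] (≐-sym e))
trim-cong {a ∷ p} {[]}    e = trim-≐-[] e
trim-cong {a ∷ p} {b ∷ r} e = cong₂ consTrim (at e zero) (trim-cong (∷-injectiveʳ e))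

trim-trimmed : ∀ p → Trimmed (trim p)
trim-trimmed p = trim-cong (trim-≐ p)

≐⇒≈P : ∀ {p r} → p ≐ r → p ≈P r
≐⇒≈P {p} {r} e = trans (normalize≡trim p) (trans (trim-cong e) (sym (normalize≡trim r)))

normalize-≐ : ∀ p → normalize p ≐ p
normalize-≐ p = subst (_≐ p) (sym (normalize≡trim p)) (trim-≐ p)

normalize-trimmed : ∀ p → Trimmed (normalize p)
normalize-trimmed p = subst Trimmed (sym (normalize≡trim p)) (trim-trimmed p)

length-trim : ∀ p → length (trim p) ≤ length p
length-trim []      = z≤n
length-trim (a ∷ p) = ℕₚ.≤-trans (length-consTrim a (trim p)) (s≤s (length-trim p))
  where
  length-consTrim : ∀ a p → length (consTrim a p) ≤ suc (length p)
  length-consTrim a [] with a ℤ.≟ 0ℤ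
  ... | yes _ = z≤n
  ... | no  _ = s≤s z≤n
  length-consTrim a (b ∷ p) = ℕₚ.≤-refl

trimmed-tail : ∀ a b p → Trimmed (a ∷ b ∷ p) → Trimmed (b ∷ p)
trimmed-tail a b p t with trim (b ∷ p)
trimmed-tail a b p t    | [] with a ℤ.≟ 0ℤ
trimmed-tail a b p ()   | [] | yes _
trimmed-tail a b p ()   | [] | no  _
trimmed-tail a b p refl | c ∷ q = refl

trimmed-last≢0 : ∀ a p → Trimmed (a ∷ p) → coeff (a ∷ p) (length p) ≢ 0ℤ
trimmed-last≢0 a [] t with a ℤ.≟ 0ℤ
trimmed-last≢0 a [] () | yes _
... | no a≢0 = a≢0
trimmed-last≢0 a (b ∷ p) t = trimmed-last≢0 b p (trimmed-tail a b p t)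

DegreeBelow : ℕ → Poly → Set
DegreeBelow m p = ∀ i → m ≤ i → coeff p i ≡ 0ℤ

degreeBelow-cong : ∀ {m p r} → p ≐ r → DegreeBelow m p → DegreeBelow m r
degreeBelow-cong e deg i m≤i = trans (sym (at e i)) (deg i m≤i)

degreeBelow-0 : ∀ {p} → DegreeBelow 0 p → p ≐ []
degreeBelow-0 deg = coeffwise λ i → deg i z≤n

degreeBelow-length : ∀ p → DegreeBelow (length p) p
degreeBelow-length []      i       _       = refl
degreeBelow-length (a ∷ p) (suc i) (s≤s h) = degreeBelow-length p i h

coeff≢0⇒<length : ∀ p j → coeff p j ≢ 0ℤ → j < length p
coeff≢0⇒<length p j c≢0 with j <? length p
... | yes j<len = j<len
... | no  j≮len = ⊥-elim (c≢0 (degreeBelow-length p j (ℕₚ.≮⇒≥ j≮len)))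

trimmed-length≤ : ∀ {p m} → Trimmed p → DegreeBelow m p → length p ≤ m
trimmed-length≤ {[]}    _ _   = z≤n
trimmed-length≤ {a ∷ p} {m} t deg with m <? length (a ∷ p)
... | no  m≮len = ℕₚ.≮⇒≥ m≮len
... | yes m<len = ⊥-elim (trimmed-last≢0 a p t (deg (length p) (ℕₚ.≤-pred m<len)))

Monic : ℕ → Poly → Set
Monic b d = DegreeBelow (suc b) d × coeff d b ≡ 1ℤ

coeff-∷-*P : ∀ a p r i → coeff ((a ∷ p) *P r) i ≡ a *ℤ coeff r i +ℤ coeff (0ℤ ∷ p *P r) i
coeff-∷-*P a p r i =
  trans (coeff-+P (scaleP a r) (0ℤ ∷ p *P r) i) (cong (_+ℤ coeff (0ℤ ∷ p *P r) i) (coeff-scaleP a r i))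

degreeBelow-tail : ∀ {a x p} → DegreeBelow (suc a) (x ∷ p) → DegreeBelow a p
degreeBelow-tail deg i a≤i = deg (suc i) (s≤s a≤i)

*P-degreeBelow : ∀ {a b} p r → DegreeBelow a p → DegreeBelow (suc b) r → DegreeBelow (a + b) (p *P r)
*P-degreeBelow []      r _    _    i _ = refl
*P-degreeBelow {zero}  (x ∷ p) r degp degr i _ = at (*P-zeroˡ (x ∷ p) r (degreeBelow-0 degp)) i
*P-degreeBelow {suc a} {b} (x ∷ p) r degp degr (suc i) (s≤s a+b≤i) = begin
  coeff ((x ∷ p) *P r) (suc i)     ≡⟨ coeff-∷-*P x p r (suc i) ⟩
  x *ℤ coeff r (suc i) +ℤ coeff (p *P r) i
    ≡⟨ cong₂ _+ℤ_ (cong (x *ℤ_) (degr (suc i) (s≤s (ℕₚ.≤-trans (ℕₚ.m≤n+m b a) a+b≤i))))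
                  (*P-degreeBelow p r (degreeBelow-tail {x = x} degp) degr i a+b≤i) ⟩
  x *ℤ 0ℤ +ℤ 0ℤ                    ≡⟨ trans (ℤₚ.+-identityʳ _) (ℤₚ.*-zeroʳ x) ⟩
  0ℤ                               ∎
  where open ≡-Reasoning

*P-coeff-top : ∀ {a b} p r → DegreeBelow (suc a) p → DegreeBelow (suc b) r →
               coeff (p *P r) (a + b) ≡ coeff p a *ℤ coeff r b
*P-coeff-top {a} {b} [] r _ _ = sym (ℤₚ.*-zeroˡ (coeff r b))
*P-coeff-top {zero} {b} (x ∷ p) r degp degr = begin
  coeff ((x ∷ p) *P r) b               ≡⟨ coeff-∷-*P x p r b ⟩
  x *ℤ coeff r b +ℤ coeff (0ℤ ∷ p *P r) b
    ≡⟨ cong (x *ℤ coeff r b +ℤ_)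
            (at (∷-≐-[] refl (*P-zeroˡ p r (degreeBelow-0 (degreeBelow-tail {x = x} degp)))) b) ⟩
  x *ℤ coeff r b +ℤ 0ℤ                 ≡⟨ ℤₚ.+-identityʳ _ ⟩
  x *ℤ coeff r b                       ∎
  where open ≡-Reasoning
*P-coeff-top {suc a} {b} (x ∷ p) r degp degr = begin
  coeff ((x ∷ p) *P r) (suc (a + b))   ≡⟨ coeff-∷-*P x p r (suc (a + b)) ⟩
  x *ℤ coeff r (suc (a + b)) +ℤ coeff (p *P r) (a + b)
    ≡⟨ cong₂ _+ℤ_ (cong (x *ℤ_) (degr (suc (a + b)) (s≤s (ℕₚ.m≤n+m b a))))
                  (*P-coeff-top p r (degreeBelow-tail {x = x} degp) degr) ⟩
  x *ℤ 0ℤ +ℤ coeff p a *ℤ coeff r b     ≡⟨ cong (_+ℤ coeff p a *ℤ coeff r b) (ℤₚ.*-zeroʳ x) ⟩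
  0ℤ +ℤ coeff p a *ℤ coeff r b          ≡⟨ ℤₚ.+-identityˡ _ ⟩
  coeff p a *ℤ coeff r b                ∎
  where open ≡-Reasoning

monic-*P : ∀ {a b} p r → Monic a p → Monic b r → Monic (a + b) (p *P r)
monic-*P p r (degp , topp) (degr , topr) =
  *P-degreeBelow p r degp degr , trans (*P-coeff-top p r degp degr) (cong₂ _*ℤ_ topp topr)

monic-oneP : Monic 0 oneP
monic-oneP = (λ { zero () ; (suc i) _ → refl }) , refl

leadingCoeff? : ∀ p → p ≐ [] ⊎ ∃ λ a → DegreeBelow (suc a) p × coeff p a ≢ 0ℤ
leadingCoeff? p with trim p | trim-≐ p | trim-trimmed p
... | []     | trim≐p | _ = inj₁ (≐-sym trim≐p)
... | a ∷ q  | trim≐p | t = inj₂ (length q , degreeBelow-cong trim≐p (degreeBelow-length (a ∷ q)) ,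
                                   λ top≡0 → trimmed-last≢0 a q t (trans (at trim≐p (length q)) top≡0))

subP-cancel-top : ∀ {a} p → DegreeBelow (suc a) p → DegreeBelow a (p -P scaleP (coeff p a) (qPow a))
subP-cancel-top {a} p deg i a≤i = trans (coeff-subP p _ i)
  (trans (cong (λ c → coeff p i +ℤ -1ℤ *ℤ c) (coeff-scaleP (coeff p a) (qPow a) i)) cancel)
  where
  open +-*-Solver
  cancel : coeff p i +ℤ -1ℤ *ℤ (coeff p a *ℤ coeff (qPow a) i) ≡ 0ℤ
  cancel with a <? i
  ... | yes a<i rewrite deg i a<i | coeff-qPow-> a i a<i =
    solve 1 (λ x → con 0ℤ :+ con -1ℤ :* (x :* con 0ℤ) := con 0ℤ) refl (coeff p a)
  ... | no a≮i rewrite ℕₚ.≤-antisym a≤i (ℕₚ.≮⇒≥ a≮i) | coeff-qPow-self i =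
    solve 1 (λ x → x :+ con -1ℤ :* (x :* con 1ℤ) := con 0ℤ) refl (coeff p i)

subP-*P : ∀ p r s → (p -P r) *P s ≐ p *P s -P r *P s
subP-*P p r s = ≐-trans (*P-distribʳ p (negP r) s) (+P-cong (≐-refl {p *P s}) (≐-sym (scaleP-*P -1ℤ r s)))

+P-subP : ∀ p r → p +P (r -P p) ≐ r
+P-subP p r = coeffwise λ i →
  trans (coeff-+P p (r -P p) i) (trans (cong (coeff p i +ℤ_) (coeff-subP r p i))
    (solve 2 (λ x y → x :+ (y :+ con -1ℤ :* x) := y) refl (coeff p i) (coeff r i)))
  where open +-*-Solver

-- `divMonic` runs on helpers that Defs keeps private.  They are named here as metavariables,
-- solved by unification from the equations in the same mutual block, so that they compute.
mutual
  divisionLoop : (fuel : ℕ) (p d : Poly) → Dec (length p < length d) → Poly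
  divisionLoop = _

  lastCoeff : Poly → ℤ
  lastCoeff = _

  divMonic-loop : ∀ p d → divMonic p d ≡
    divisionLoop (length p) (normalize p) (normalize d) (length (normalize p) <? length (normalize d))
  divMonic-loop p d with length p | normalize p | normalize d
  ... | n | p′ | d′ with length p′ <? length d′
  ... | _ = refl

  divisionLoop-suc : ∀ m p d ¬lt → divisionLoop (suc m) p d (no ¬lt) ≡
    let t = scaleP (lastCoeff p) (qPow (length p ∸ length d))
        r = normalize (p -P t *P d)
    in t +P divisionLoop m r d (length r <? length d)
  divisionLoop-suc _ _ _ _ = refl

leadingQuotient : Poly → Poly → Poly
leadingQuotient p d = scaleP (lastCoeff p) (qPow (length p ∸ length d))

lastCoeff-coeff : ∀ p {n} → length p ≡ suc n → lastCoeff p ≡ coeff p n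
lastCoeff-coeff (a ∷ [])    refl = refl
lastCoeff-coeff (a ∷ b ∷ p) refl = lastCoeff-coeff (b ∷ p) refl

module ExactDivision {D : Poly} {b : ℕ} (D-trimmed : Trimmed D) (D-monic : Monic b D) where

  length-D : length D ≡ suc b
  length-D = ℕₚ.≤-antisym (trimmed-length≤ D-trimmed (proj₁ D-monic))
                          (coeff≢0⇒<length D b (λ top≡0 → 1≢0 (trans (sym (proj₂ D-monic)) top≡0)))
    where
    1≢0 : 1ℤ ≢ 0ℤ
    1≢0 ()

  leadingQuotient-multiple : ∀ p Q {a} → Trimmed p → p ≐ Q *P D →
                             DegreeBelow (suc a) Q → coeff Q a ≢ 0ℤ →
                             length p ≡ suc (a + b) × leadingQuotient p D ≡ scaleP (coeff Q a) (qPow a)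
  leadingQuotient-multiple p Q {a} p-trimmed p≐QD degQ top≢0 =
    length-p , cong₂ scaleP lastCoeff-p (cong qPow length-p∸D)
    where
    deg-p : DegreeBelow (suc (a + b)) p
    deg-p = degreeBelow-cong (≐-sym p≐QD) (*P-degreeBelow Q D degQ (proj₁ D-monic))
    top-p : coeff p (a + b) ≡ coeff Q a
    top-p = trans (at p≐QD (a + b)) (trans (*P-coeff-top Q D degQ (proj₁ D-monic))
              (trans (cong (coeff Q a *ℤ_) (proj₂ D-monic)) (ℤₚ.*-identityʳ _)))
    length-p : length p ≡ suc (a + b)
    length-p = ℕₚ.≤-antisym (trimmed-length≤ p-trimmed deg-p)
                            (coeff≢0⇒<length p (a + b) (λ c≡0 → top≢0 (trans (sym top-p) c≡0)))
    lastCoeff-p : lastCoeff p ≡ coeff Q a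
    lastCoeff-p = trans (lastCoeff-coeff p length-p) top-p
    length-p∸D : length p ∸ length D ≡ a
    length-p∸D = trans (cong₂ _∸_ length-p length-D) (ℕₚ.m+n∸n≡m a b)

  -- Each step cancels the leading term of the dividend, so `length p` steps suffice.
  divisionLoop-exact : ∀ fuel p Q dec → Trimmed p → length p ≤ fuel → p ≐ Q *P D →
                       divisionLoop fuel p D dec ≐ Q
  divisionLoop-exact fuel p Q dec p-trimmed p≤fuel p≐QD with leadingCoeff? Q
  ... | inj₁ Q≐0 = zero-quotient dec
    where
    p≡[] : p ≡ []
    p≡[] = trans (sym p-trimmed) (trim-≐-[] (≐-trans p≐QD (*P-zeroˡ Q D Q≐0)))
    zero-quotient : ∀ dec → divisionLoop fuel p D dec ≐ Q
    zero-quotient (yes _)  = ≐-sym Q≐0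
    zero-quotient (no p≮D) = ⊥-elim (p≮D (subst₂ _<_ (sym (cong length p≡[])) (sym length-D) (s≤s z≤n)))
  ... | inj₂ (a , degQ , top≢0) = long-division fuel dec p≤fuel
    where
    leading = leadingQuotient-multiple p Q p-trimmed p≐QD degQ top≢0
    long-division : ∀ fuel dec → length p ≤ fuel → divisionLoop fuel p D dec ≐ Q
    long-division _ (yes p<D) _ =
      ⊥-elim (ℕₚ.≤⇒≯ (ℕₚ.m≤n+m b a) (ℕₚ.≤-pred (subst₂ _<_ (proj₁ leading) length-D p<D)))
    long-division zero (no _) p≤0 = ⊥-elim (ℕₚ.n≮0 (subst (_≤ 0) (proj₁ leading) p≤0))
    long-division (suc m) (no p≮D) p≤fuel = begin
      divisionLoop (suc m) p D (no p≮D)              ≡⟨ divisionLoop-suc m p D p≮D ⟩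
      t +P divisionLoop m r D (length r <? length D)
        ≈⟨ +P-cong (≐-refl {t})
                   (divisionLoop-exact m r (Q -P t) (length r <? length D) r-trimmed r≤m r≐Q′D) ⟩
      t +P (Q -P t)                                  ≈⟨ +P-subP t Q ⟩
      Q                                              ∎
      where
      open ≐-Reasoning
      t = leadingQuotient p D
      r = normalize (p -P t *P D)
      r-trimmed : Trimmed r
      r-trimmed = normalize-trimmed (p -P t *P D)
      r≐Q′D : r ≐ (Q -P t) *P D
      r≐Q′D = ≐-trans (normalize-≐ _)
                (≐-trans (+P-cong p≐QD (≐-refl {negP (t *P D)})) (≐-sym (subP-*P Q t D)))
      deg-Q′ : DegreeBelow a (Q -P t)
      deg-Q′ = subst (λ t → DegreeBelow a (Q -P t)) (sym (proj₂ leading)) (subP-cancel-top Q degQ)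
      r≤m : length r ≤ m
      r≤m = ℕₚ.≤-trans
        (trimmed-length≤ r-trimmed
          (degreeBelow-cong (≐-sym r≐Q′D) (*P-degreeBelow (Q -P t) D deg-Q′ (proj₁ D-monic))))
        (ℕₚ.≤-pred (subst (_≤ suc m) (proj₁ leading) p≤fuel))

divMonic-exact : ∀ {b p d Q} → Monic b d → p ≐ Q *P d → divMonic p d ≐ Q
divMonic-exact {b} {p} {d} {Q} (deg-d , top-d) p≐Qd = subst (_≐ Q) (sym (divMonic-loop p d))
  (divisionLoop-exact (length p) (normalize p) Q (length (normalize p) <? length (normalize d))
    (normalize-trimmed p) length-normalize
    (≐-trans (normalize-≐ p) (≐-trans p≐Qd (*P-congʳ Q (≐-sym (normalize-≐ d))))))
  where
  d′≐d = normalize-≐ d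
  open ExactDivision (normalize-trimmed d) (degreeBelow-cong (≐-sym d′≐d) deg-d , trans (at d′≐d b) top-d)
  length-normalize : length (normalize p) ≤ length p
  length-normalize = subst (λ r → length r ≤ length p) (sym (normalize≡trim p)) (length-trim p)

prodFrom : (ℕ → Poly) → (start count : ℕ) → Poly
prodFrom f i zero    = oneP
prodFrom f i (suc c) = f i *P prodFrom f (suc i) c

-- The same device names the local loop of `prodFromTo`.
mutual
  prodFromTo-loop : ℕ → ℕ → (ℕ → Poly) → ℕ → ℕ → Poly
  prodFromTo-loop = _

  prodFromTo-unfold : ∀ a b f c → suc b ∸ a ≡ suc c →
                      prodFromTo a b f ≡ f a *P prodFromTo-loop a b f c (suc a)
  prodFromTo-unfold a b f c eq rewrite eq with suc a
  ... | _ = refl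

prodFromTo-loop≡prodFrom : ∀ a b f c i → prodFromTo-loop a b f c i ≡ prodFrom f i c
prodFromTo-loop≡prodFrom a b f zero    i = refl
prodFromTo-loop≡prodFrom a b f (suc c) i = cong (f i *P_) (prodFromTo-loop≡prodFrom a b f c (suc i))

prodFromTo≡prodFrom : ∀ a b f → prodFromTo a b f ≡ prodFrom f a (suc b ∸ a)
prodFromTo≡prodFrom a b f = prodFromTo-loop≡prodFrom a b f (suc b ∸ a) a

prodFrom-suc : ∀ f i c → prodFrom f i (suc c) ≐ prodFrom f i c *P f (i + c)
prodFrom-suc f i zero =
  ≐-trans (*P-identityʳ (f i))
          (≐-sym (≐-trans (*P-identityˡ (f (i + 0))) (≡⇒≐ (cong f (ℕₚ.+-identityʳ i)))))
prodFrom-suc f i (suc c) = begin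
  f i *P prodFrom f (suc i) (suc c)              ≈⟨ *P-congʳ (f i) (prodFrom-suc f (suc i) c) ⟩
  f i *P (prodFrom f (suc i) c *P f (suc i + c)) ≈⟨ ≐-sym (*P-assoc (f i) _ _) ⟩
  prodFrom f i (suc c) *P f (suc i + c)
    ≡⟨ cong (λ j → prodFrom f i (suc c) *P f j) (sym (ℕₚ.+-suc i c)) ⟩
  prodFrom f i (suc c) *P f (i + suc c)          ∎
  where open ≐-Reasoning

qPow-+ : ∀ a c → qPow (a + c) ≐ qPow a *P qPow c
qPow-+ zero    c = ≐-sym (*P-identityˡ (qPow c))
qPow-+ (suc a) c = ≐-trans (∷-cong refl (qPow-+ a c)) (≐-sym (0∷-*P (qPow a) (qPow c)))

qInt-+ : ∀ a c → qInt (a + c) ≐ qInt a +P qPow a *P qInt c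
qInt-+ zero    c = ≐-sym (*P-identityˡ (qInt c))
qInt-+ (suc a) c =
  ≐-trans (∷-cong refl (qInt-+ a c)) (≐-sym (+P-cong (≐-refl {qInt (suc a)}) (0∷-*P (qPow a) (qInt c))))

qFact≡prodFrom : ∀ k → qFact k ≡ prodFrom qInt 1 k
qFact≡prodFrom k = prodFromTo≡prodFrom 1 k qInt

qFact-suc : ∀ k → qFact (suc k) ≐ qFact k *P qInt (suc k)
qFact-suc k rewrite qFact≡prodFrom (suc k) | qFact≡prodFrom k = prodFrom-suc qInt 1 k

qInt-monic : ∀ i → Monic i (qInt (suc i))
qInt-monic i =
  subst (λ n → DegreeBelow n (qInt (suc i))) (Listₚ.length-replicate (suc i))
        (degreeBelow-length (qInt (suc i))) ,
  top i
  where
  top : ∀ i → coeff (qInt (suc i)) i ≡ 1ℤ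
  top zero    = refl
  top (suc i) = top i

qFact-monic : ∀ k → ∃ λ b → Monic b (qFact k)
qFact-monic k rewrite qFact≡prodFrom k = prodFrom-qInt-monic 0 k
  where
  prodFrom-qInt-monic : ∀ i c → ∃ λ b → Monic b (prodFrom qInt (suc i) c)
  prodFrom-qInt-monic i zero    = 0 , monic-oneP
  prodFrom-qInt-monic i (suc c) =
    let b , monic = prodFrom-qInt-monic (suc i) c
    in i + b , monic-*P (qInt (suc i)) (prodFrom qInt (suc (suc i)) c) (qInt-monic i) monic

qBinomPascal : ℕ → ℕ → Poly
qBinomPascal n       zero    = oneP
qBinomPascal zero    (suc k) = []
qBinomPascal (suc n) (suc k) = qPow (suc k) *P qBinomPascal n (suc k) +P qBinomPascal n k

qBinomPascal-≐-[] : ∀ n k → n ≤ k → qBinomPascal n (suc k) ≐ []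
qBinomPascal-≐-[] zero    k       _       = ≐-refl
qBinomPascal-≐-[] (suc n) (suc k) (s≤s h) =
  +P-cong (≐-trans (*P-congʳ (qPow (suc (suc k))) (qBinomPascal-≐-[] n (suc k) (ℕₚ.m≤n⇒m≤1+n h)))
                   (*P-zeroʳ (qPow (suc (suc k)))))
          (qBinomPascal-≐-[] n k h)

qBinomPascal-diag : ∀ n → qBinomPascal n n ≐ oneP
qBinomPascal-diag zero    = ≐-refl
qBinomPascal-diag (suc n) =
  +P-cong (≐-trans (*P-congʳ (qPow (suc n)) (qBinomPascal-≐-[] n n ℕₚ.≤-refl)) (*P-zeroʳ (qPow (suc n))))
          (qBinomPascal-diag n)

qFact-split : ∀ k m → qFact (k + m) ≐ qBinomPascal (k + m) k *P (qFact k *P qFact m)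
qFact-split zero    m    = ≐-sym (≐-trans (*P-identityˡ _) (*P-identityˡ _))
qFact-split (suc k) zero rewrite ℕₚ.+-identityʳ k = begin
  qFact (suc k)                                   ≈⟨ ≐-sym (≐-trans (*P-identityˡ _) (*P-identityʳ _)) ⟩
  oneP *P (qFact (suc k) *P oneP)                 ≈⟨ *P-congˡ _ (≐-sym (qBinomPascal-diag (suc k))) ⟩
  qBinomPascal (suc k) (suc k) *P (qFact (suc k) *P oneP) ∎
  where open ≐-Reasoning
qFact-split (suc k) (suc m) = begin
  qFact (suc N)                                   ≈⟨ qFact-suc N ⟩
  qFact N *P qInt (suc k + suc m)                 ≈⟨ *P-congʳ (qFact N) (qInt-+ (suc k) (suc m)) ⟩
  qFact N *P ([k+1] +P q^k+1 *P [m+1])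
    ≈⟨ solve 4 (λ f i q j → f :* (i :+ q :* j) := q :* j :* f :+ i :* f)
               ≐-refl (qFact N) [k+1] q^k+1 [m+1] ⟩
  q^k+1 *P [m+1] *P qFact N +P [k+1] *P qFact N
    ≈⟨ +P-cong (*P-congʳ (q^k+1 *P [m+1]) split-k+1) (*P-congʳ [k+1] split-k) ⟩
  q^k+1 *P [m+1] *P (qBinomPascal N (suc k) *P ((qFact k *P [k+1]) *P qFact m))
    +P [k+1] *P (qBinomPascal N k *P (qFact k *P (qFact m *P [m+1])))
    ≈⟨ solve 7 (λ q j i b₁ b₀ f g → q :* j :* (b₁ :* ((f :* i) :* g)) :+ i :* (b₀ :* (f :* (g :* j)))
                                   := (q :* b₁ :+ b₀) :* ((f :* i) :* (g :* j)))
               ≐-refl q^k+1 [m+1] [k+1] (qBinomPascal N (suc k)) (qBinomPascal N k) (qFact k) (qFact m) ⟩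
  (q^k+1 *P qBinomPascal N (suc k) +P qBinomPascal N k) *P ((qFact k *P [k+1]) *P (qFact m *P [m+1]))
    ≈⟨ *P-congʳ (qBinomPascal (suc N) (suc k)) (*P-cong (≐-sym (qFact-suc k)) (≐-sym (qFact-suc m))) ⟩
  qBinomPascal (suc N) (suc k) *P (qFact (suc k) *P qFact (suc m)) ∎
  where
  open ≐-Reasoning
  open PolySolver using (solve; _:+_; _:*_; _:=_)
  N = k + suc m
  [k+1] = qInt (suc k)
  [m+1] = qInt (suc m)
  q^k+1 = qPow (suc k)
  split-k+1 : qFact N ≐ qBinomPascal N (suc k) *P ((qFact k *P [k+1]) *P qFact m)
  split-k+1 = subst (λ n → qFact n ≐ qBinomPascal n (suc k) *P ((qFact k *P [k+1]) *P qFact m))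
                    (sym (ℕₚ.+-suc k m))
                    (≐-trans (qFact-split (suc k) m)
                             (*P-congʳ (qBinomPascal (suc k + m) (suc k)) (*P-congˡ (qFact m) (qFact-suc k))))
  split-k : qFact N ≐ qBinomPascal N k *P (qFact k *P (qFact m *P [m+1]))
  split-k = ≐-trans (qFact-split k (suc m)) (*P-congʳ (qBinomPascal N k) (*P-congʳ (qFact k) (qFact-suc m)))

qBinom≐qBinomPascal : ∀ {n k} → k ≤ n → qBinom n k ≐ qBinomPascal n k
qBinom≐qBinomPascal {n} {k} k≤n =
  divMonic-exact (monic-*P (qFact k) (qFact (n ∸ k)) (proj₂ (qFact-monic k)) (proj₂ (qFact-monic (n ∸ k))))
    (subst (λ m → qFact m ≐ qBinomPascal m k *P (qFact k *P qFact (n ∸ k)))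
           (ℕₚ.m+[n∸m]≡n k≤n) (qFact-split k (n ∸ k)))

sumP-cong : ∀ n {f g} → (∀ k → k ≤ n → f k ≐ g k) → sumP n f ≐ sumP n g
sumP-cong zero    f≐g = f≐g 0 z≤n
sumP-cong (suc n) f≐g =
  +P-cong (sumP-cong n (λ k k≤n → f≐g k (ℕₚ.m≤n⇒m≤1+n k≤n))) (f≐g (suc n) ℕₚ.≤-refl)

sumP-+P : ∀ n f g → sumP n (λ k → f k +P g k) ≐ sumP n f +P sumP n g
sumP-+P zero    f g = ≐-refl
sumP-+P (suc n) f g = ≐-trans (+P-cong (sumP-+P n f g) (≐-refl {f (suc n) +P g (suc n)}))
                              (+P-interchange (sumP n f) (sumP n g) (f (suc n)) (g (suc n)))

sumP-suc : ∀ n f → sumP (suc n) f ≐ f 0 +P sumP n (λ k → f (suc k))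
sumP-suc zero    f = ≐-refl
sumP-suc (suc n) f = ≐-trans (+P-cong (sumP-suc n f) (≐-refl {f (suc (suc n))})) (+P-assoc (f 0) _ _)

sumP-+P-shift : ∀ n f g → f (suc n) ≐ [] →
                f 0 +P sumP n (λ k → f (suc k) +P g k) ≐ sumP n (λ k → f k +P g k)
sumP-+P-shift n f g f[n+1]≐0 = begin
  f 0 +P sumP n (λ k → f (suc k) +P g k)               ≈⟨ +P-cong (≐-refl {f 0}) (sumP-+P n (λ k → f (suc k)) g) ⟩
  f 0 +P (sumP n (λ k → f (suc k)) +P sumP n g)        ≈⟨ ≐-sym (+P-assoc (f 0) _ _) ⟩
  (f 0 +P sumP n (λ k → f (suc k))) +P sumP n g        ≈⟨ +P-cong (≐-sym (sumP-suc n f)) (≐-refl {sumP n g}) ⟩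
  (sumP n f +P f (suc n)) +P sumP n g
    ≈⟨ +P-cong (≐-trans (+P-cong (≐-refl {sumP n f}) f[n+1]≐0) (+P-identityʳ _)) (≐-refl {sumP n g}) ⟩
  sumP n f +P sumP n g                                 ≈⟨ ≐-sym (sumP-+P n f g) ⟩
  sumP n (λ k → f k +P g k)                            ∎
  where open ≐-Reasoning

1-q^ : ℕ → Poly
1-q^ j = oneP -P qPow j

1-q^-+P-q^ : ∀ j → 1-q^ j +P qPow j ≐ oneP
1-q^-+P-q^ j = coeffwise λ i →
  trans (coeff-+P (1-q^ j) (qPow j) i) (trans (cong (_+ℤ coeff (qPow j) i) (coeff-subP oneP (qPow j) i))
    (solve 2 (λ x y → (x :+ con -1ℤ :* y) :+ y := x) refl (coeff oneP i) (coeff (qPow j) i)))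
  where open +-*-Solver

summand : (e n k : ℕ) → Poly
summand e n k = qBinomPascal n k *P qPow (k * k + e * k) *P prodFrom 1-q^ (k + 1 + e) (n ∸ k)

summandSum : (e n : ℕ) → Poly
summandSum e n = sumP n (summand e n)

module PascalStep (e n : ℕ) where
  U V : ℕ → Poly
  U k = qPow k *P qBinomPascal n k *P qPow (k * k + e * k) *P prodFrom 1-q^ (k + 1 + e) (suc n ∸ k)
  V k = qBinomPascal n k *P qPow (suc k * suc k + e * suc k) *P prodFrom 1-q^ (suc k + 1 + e) (n ∸ k)

  summand-0 : summand e (suc n) 0 ≐ U 0
  summand-0 = *P-congˡ (prodFrom 1-q^ (1 + e) (suc n)) (*P-congˡ (qPow (e * 0)) (≐-sym (*P-identityˡ oneP)))

  summand-suc : ∀ k → summand e (suc n) (suc k) ≐ U (suc k) +P V k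
  summand-suc k =
    solve 5 (λ q b₁ b₀ x p → (q :* b₁ :+ b₀) :* x :* p := q :* b₁ :* x :* p :+ b₀ :* x :* p) ≐-refl
      (qPow (suc k)) (qBinomPascal n (suc k)) (qBinomPascal n k)
      (qPow (suc k * suc k + e * suc k)) (prodFrom 1-q^ (suc k + 1 + e) (n ∸ k))
    where open PolySolver using (solve; _:+_; _:*_; _:=_)

  U-last : U (suc n) ≐ []
  U-last = *P-zeroˡ _ _ (*P-zeroˡ _ _
    (≐-trans (*P-congʳ (qPow (suc n)) (qBinomPascal-≐-[] n n ℕₚ.≤-refl)) (*P-zeroʳ (qPow (suc n)))))

  U+V : ∀ k → k ≤ n → U k +P V k ≐ summand (suc e) n k
  U+V k k≤n = begin
    U k +P V k
      ≈⟨ +P-cong (≡⇒≐ (cong (λ c → q^k *P B *P X *P prodFrom 1-q^ j c) (ℕₚ.+-∸-assoc 1 k≤n)))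
                 (*P-congˡ P (*P-congʳ B exponent-suc)) ⟩
    q^k *P B *P X *P (1-q^ j *P P) +P B *P (qPow j *P (q^k *P X)) *P P
      ≈⟨ solve 6 (λ a b x g p u → a :* b :* x :* (g :* p) :+ b :* (u :* (a :* x)) :* p
                                  := (b :* (a :* x) :* p) :* (g :+ u))
                 ≐-refl q^k B X (1-q^ j) P (qPow j) ⟩
    (B *P (q^k *P X) *P P) *P (1-q^ j +P qPow j)     ≈⟨ *P-congʳ (B *P (q^k *P X) *P P) (1-q^-+P-q^ j) ⟩
    (B *P (q^k *P X) *P P) *P oneP                   ≈⟨ *P-identityʳ _ ⟩
    B *P (q^k *P X) *P P
      ≈⟨ *P-cong (*P-congʳ B (≐-sym exponent-e+1))
                 (≡⇒≐ (cong (λ i → prodFrom 1-q^ i (n ∸ k)) (sym (ℕₚ.+-suc (k + 1) e)))) ⟩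
    summand (suc e) n k                              ∎
    where
    open ≐-Reasoning
    open PolySolver using (solve; _:+_; _:*_; _:=_)
    j = k + 1 + e
    q^k = qPow k
    B = qBinomPascal n k
    X = qPow (k * k + e * k)
    P = prodFrom 1-q^ (suc j) (n ∸ k)
    exponent-suc : qPow (suc k * suc k + e * suc k) ≐ qPow j *P (q^k *P X)
    exponent-suc = ≐-trans (≡⇒≐ (cong qPow (rearrange k e)))
                           (≐-trans (qPow-+ j _) (*P-congʳ (qPow j) (qPow-+ k _)))
      where
      rearrange : ∀ k e → suc k * suc k + e * suc k ≡ k + 1 + e + (k + (k * k + e * k))
      rearrange = solve-∀
    exponent-e+1 : qPow (k * k + suc e * k) ≐ q^k *P X
    exponent-e+1 = ≐-trans (≡⇒≐ (cong qPow (rearrange k e))) (qPow-+ k _)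
      where
      rearrange : ∀ k e → k * k + suc e * k ≡ k + (k * k + e * k)
      rearrange = solve-∀

  summandSum-suc : summandSum e (suc n) ≐ summandSum (suc e) n
  summandSum-suc = begin
    sumP (suc n) (summand e (suc n))
      ≈⟨ sumP-suc n (summand e (suc n)) ⟩
    summand e (suc n) 0 +P sumP n (λ k → summand e (suc n) (suc k))
      ≈⟨ +P-cong summand-0 (sumP-cong n (λ k _ → summand-suc k)) ⟩
    U 0 +P sumP n (λ k → U (suc k) +P V k)    ≈⟨ sumP-+P-shift n U V U-last ⟩
    sumP n (λ k → U k +P V k)                 ≈⟨ sumP-cong n U+V ⟩
    sumP n (summand (suc e) n)                ∎
    where open ≐-Reasoning

summandSum≐1 : ∀ n e → summandSum e n ≐ oneP
summandSum≐1 zero    e =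
  ≐-trans (*P-identityʳ _) (≐-trans (*P-identityˡ _) (≡⇒≐ (cong qPow (ℕₚ.*-zeroʳ e))))
summandSum≐1 (suc n) e = ≐-trans (PascalStep.summandSum-suc e n) (summandSum≐1 n (suc e))

prodFromTo-count : ∀ {k n} e → k ≤ n → suc (n + e) ∸ (k + 1 + e) ≡ n ∸ k
prodFromTo-count {k} {n} e k≤n = begin
  suc (n + e) ∸ (k + 1 + e)             ≡⟨ cong (λ m → suc (m + e) ∸ (k + 1 + e)) (sym (ℕₚ.m+[n∸m]≡n k≤n)) ⟩
  suc (k + (n ∸ k) + e) ∸ (k + 1 + e)   ≡⟨ cong (_∸ (k + 1 + e)) (rearrange k (n ∸ k) e) ⟩
  k + 1 + e + (n ∸ k) ∸ (k + 1 + e)     ≡⟨ ℕₚ.m+n∸m≡n (k + 1 + e) (n ∸ k) ⟩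
  n ∸ k                                 ∎
  where
  open ≡-Reasoning
  rearrange : ∀ k d e → suc (k + d + e) ≡ k + 1 + e + d
  rearrange = solve-∀

lemma3p2 : (e n : ℕ) →
    sumP n (λ k → qBinom n k *P qPow (k * k + e * k) *P prodFromTo (k + 1 + e) (n + e) (λ j → oneP -P qPow j)) ≈P oneP
lemma3p2 e n = ≐⇒≈P (≐-trans (sumP-cong n summand-statement) (summandSum≐1 n e))
  where
  summand-statement : ∀ k → k ≤ n →
    qBinom n k *P qPow (k * k + e * k) *P prodFromTo (k + 1 + e) (n + e) 1-q^ ≐ summand e n k
  summand-statement k k≤n = *P-cong (*P-congˡ (qPow (k * k + e * k)) (qBinom≐qBinomPascal k≤n))
    (≡⇒≐ (trans (prodFromTo≡prodFrom (k + 1 + e) (n + e) 1-q^)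
                (cong (prodFrom 1-q^ (k + 1 + e)) (prodFromTo-count e k≤n))))
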